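{- Let $(Q,\rightarrow)$ be a finite transition system, $\mathscr{R}_{\mathrm{init}}$ a preorder on $Q$, and $$\mathscr{R}=\mathscr{R}_{\mathrm{init}}\cap\{(c,d)\in Q\times Q\mid (\exists c'\in Q.\ c\rightarrow c')\Rightarrow(\exists d'\in Q.\ d\rightarrow d')\}.$$ Then (1) $\mathscr{R}$ is a preorder and $\mathscr{R}\circ\rightarrow^{ -1}\subseteq\rightarrow^{ -1}\circ(Q\times Q)$ (i.e. $\mathscr{R}$ is $(Q\times Q)$-stable); and (2) every simulation $\mathscr{S}$ with $\mathscr{S}\subseteq\mathscr{R}_{\mathrm{init}}$ satisfies $\mathscr{S}\subseteq\mathscr{R}$.
   Context: Composition: $\mathscr{S}\circ\mathscr{R}=\{(x,y)\mid\exists z,\ (x,z)\in\mathscr{R},(z,y)\in\mathscr{S}\}$; $\rightarrow^{ -1}$ is the inverse of $\rightarrow$. A relation $\mathscr{S}$ is a simulation if $\mathscr{S}\circ\rightarrow^{ -1}\subseteq\rightarrow^{ -1}\circ\mathscr{S}$ (equivalently: $q_1\,\mathscr{S}\,q_2$ and $q_1\rightarrow q_1'$ imply some $q_2'$ with $q_2\rightarrow q_2'$ and $q_1'\,\mathscr{S}\,q_2'$). -}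

module Defs where

open import Level using (Level; _⊔_)
open import Data.Product using (Σ; ∃; _×_; _,_)
open import Data.Unit.Polymorphic using (⊤)
open import Relation.Binary.Core using (Rel)

private variable a ℓ₁ ℓ₂ : Level

_⊚_ : {Q : Set a} → Rel Q ℓ₂ → Rel Q ℓ₁ → Rel Q (a ⊔ ℓ₁ ⊔ ℓ₂)
(S ⊚ R) x y = ∃ λ z → R x z × S z y

_⁻¹ʳ : {Q : Set a} → Rel Q ℓ₁ → Rel Q ℓ₁
(R ⁻¹ʳ) x y = R y x

_⊆ʳ_ : {Q : Set a} → Rel Q ℓ₁ → Rel Q ℓ₂ → Set (a ⊔ ℓ₁ ⊔ ℓ₂)
R ⊆ʳ S = ∀ {x y} → R x y → S x y

_∩ʳ_ : {Q : Set a} → Rel Q ℓ₁ → Rel Q ℓ₂ → Rel Q (ℓ₁ ⊔ ℓ₂)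
(R ∩ʳ S) x y = R x y × S x y

Full : {Q : Set a} → Rel Q a
Full _ _ = ⊤

IsSimulation : {Q : Set a} → Rel Q ℓ₁ → Rel Q ℓ₂ → Set (a ⊔ ℓ₁ ⊔ ℓ₂)
IsSimulation _⟶_ S = (S ⊚ (_⟶_ ⁻¹ʳ)) ⊆ʳ ((_⟶_ ⁻¹ʳ) ⊚ S)

EnabledPreserving : {Q : Set a} → Rel Q ℓ₁ → Rel Q (a ⊔ ℓ₁)
EnabledPreserving {Q = Q} _⟶_ c d = Σ Q (λ c' → c ⟶ c') → Σ Q (λ d' → d ⟶ d')

module Submission where

--  * EnabledPreserving ⟶ ("if c can move then so can d") is itself a
--    preorder: reflexivity is the identity implication and transitivity is
--    composition of implications.  Intersecting two preorders gives a
--    preorder, so R is a preorder.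
--  * Stability: if c R d and c → c', then d is enabled, so d → d' for some
--    d', which is all that (→⁻¹ ∘ Full) asks for.
--
-- None of these arguments uses finiteness of Q; the finiteness hypothesis
-- of the theorem (relevant for computing R, not for its properties) is
-- therefore ignored.

open import Defs
open import Level using (Level)
open import Data.Nat using (ℕ)
open import Data.Fin using (Fin)
open import Data.Product using (Σ; _×_; _,_)
open import Function using (id; _∘_)
open import Function.Bundles using (_↔_)
open import Relation.Binary.Core using (Rel)
open import Relation.Binary.PropositionalEquality using (_≡_; refl; isEquivalence)
open import Relation.Binary.Structures using (IsPreorder)

private variable
  a ℓ₁ ℓ₂ : Level
  Q : Set a

∩-isPreorder : {R : Rel Q ℓ₁} {S : Rel Q ℓ₂}
  → IsPreorder _≡_ R → IsPreorder _≡_ S → IsPreorder _≡_ (R ∩ʳ S)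
∩-isPreorder R-pre S-pre = record
  { isEquivalence = isEquivalence
  ; reflexive     = λ { refl → IsPreorder.refl R-pre , IsPreorder.refl S-pre }
  ; trans         = λ (r₁ , s₁) (r₂ , s₂) →
                      IsPreorder.trans R-pre r₁ r₂ , IsPreorder.trans S-pre s₁ s₂
  }

enabledPreserving-isPreorder : (_⟶_ : Rel Q ℓ₁)
  → IsPreorder _≡_ (EnabledPreserving _⟶_)
enabledPreserving-isPreorder _⟶_ = record
  { isEquivalence = isEquivalence
  ; reflexive     = λ { refl → id }
  ; trans         = λ c⇒d d⇒e → d⇒e ∘ c⇒d
  }

enabledPreserving-stable : (_⟶_ : Rel Q ℓ₁) {R : Rel Q ℓ₂}
  → R ⊆ʳ EnabledPreserving _⟶_
  → (R ⊚ (_⟶_ ⁻¹ʳ)) ⊆ʳ ((_⟶_ ⁻¹ʳ) ⊚ Full)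
enabledPreserving-stable _⟶_ R⊆EP (c , c⟶c' , cRd) with R⊆EP cRd (_ , c⟶c')
... | d' , d⟶d' = d' , _ , d⟶d'

simulation⊆enabledPreserving : (_⟶_ : Rel Q ℓ₁) (S : Rel Q ℓ₂)
  → IsSimulation _⟶_ S → S ⊆ʳ EnabledPreserving _⟶_
simulation⊆enabledPreserving _⟶_ S sim cSd (c' , c⟶c') with sim (_ , c⟶c' , cSd)
... | d' , _ , d⟶d' = d' , d⟶d'

∩-⊆ʳ : {R : Rel Q ℓ₁} {S : Rel Q ℓ₂} → (R ∩ʳ S) ⊆ʳ S
∩-⊆ʳ (_ , s) = s

proposition3 : {a ℓ₁ ℓ₂ ℓ₃ : Level} {Q : Set a}
    → (finite : Σ ℕ (λ n → Q ↔ Fin n))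
    → (_⟶_ : Rel Q ℓ₁)
    → (Rinit : Rel Q ℓ₂)
    → IsPreorder _≡_ Rinit
    → (IsPreorder _≡_ (Rinit ∩ʳ EnabledPreserving _⟶_)
    × (((Rinit ∩ʳ EnabledPreserving _⟶_) ⊚ (_⟶_ ⁻¹ʳ)) ⊆ʳ ((_⟶_ ⁻¹ʳ) ⊚ Full)))
    × ((S : Rel Q ℓ₃) → IsSimulation _⟶_ S → S ⊆ʳ Rinit
    → S ⊆ʳ (Rinit ∩ʳ EnabledPreserving _⟶_))
proposition3 _ _⟶_ Rinit Rinit-pre =
  ( ∩-isPreorder Rinit-pre (enabledPreserving-isPreorder _⟶_)
  , enabledPreserving-stable _⟶_ (∩-⊆ʳ {R = Rinit} {S = EnabledPreserving _⟶_}) )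
  , λ S sim S⊆Rinit cSd →
      S⊆Rinit cSd , simulation⊆enabledPreserving _⟶_ S sim cSd
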